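{- If $m\geq 5$, then $D_\mathcal{R}(K_2\square K_m)=m$.
   Context: $K_n$ is the complete graph of order $n$ and $\square$ the Cartesian product. A coloring of a graph $X$ is distinguishing if the identity is its only color-preserving automorphism. The distinguishing game on $X$ with $d$ colors: Gentle and Rascal alternately choose an uncolored vertex and color it with one of the $d$ colors; when all vertices are colored, Gentle wins iff the coloring is distinguishing. $D_\mathcal{R}(X)$ is the least $d$ such that Gentle has a winning strategy with $d$ colors when Rascal moves first ($\infty$ if none exists). -}

module Defs where

open import Level using (0ℓ)
open import Data.Nat using (ℕ)
open import Data.Fin using (Fin)
open import Data.Fin.Properties using () renaming (_≟_ to _≟F_)
open import Data.Maybe using (Maybe; just; nothing)
open import Data.Product using (Σ; ∃; _×_; _,_)
open import Data.Sum using (_⊎_)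
open import Relation.Nullary using (¬_; yes; no)
open import Relation.Binary.PropositionalEquality using (_≡_; _≢_)
open import Relation.Binary.Definitions using (DecidableEquality)
open import Data.Product.Properties using (≡-dec)
open import Function.Bundles using (_↔_; _⇔_; Inverse)

record Graph : Set₁ where
  field
    V   : Set
    _≟V_ : DecidableEquality V
    Adj : V → V → Set
open Graph public

K : ℕ → Graph
K n = record { V = Fin n ; _≟V_ = _≟F_ ; Adj = λ x y → x ≢ y }

_□_ : Graph → Graph → Graph
X □ Y = record
  { V = V X × V Y
  ; _≟V_ = ≡-dec (_≟V_ X) (_≟V_ Y)
  ; Adj = λ { (a , b) (a' , b') →
        (Adj X a a' × b ≡ b') ⊎ (a ≡ a' × Adj Y b b') }
  }

record Automorphism (X : Graph) : Set where
  field
    bij      : V X ↔ V X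
    preserve : ∀ x y → Adj X x y ⇔ Adj X (Inverse.to bij x) (Inverse.to bij y)
open Automorphism public

Coloring : Graph → ℕ → Set
Coloring X d = V X → Fin d

Distinguishing : (X : Graph) {d : ℕ} → Coloring X d → Set
Distinguishing X c =
  ∀ (φ : Automorphism X) →
  (∀ x → c (Inverse.to (bij φ) x) ≡ c x) →
  ∀ x → Inverse.to (bij φ) x ≡ x

-- Partial colorings (positions of the game)
Partial : Graph → ℕ → Set
Partial X d = V X → Maybe (Fin d)

update : (X : Graph) {d : ℕ} → Partial X d → V X → Fin d → Partial X d
update X p v c w with _≟V_ X w v
... | yes _ = just c
... | no  _ = p w

Move : (X : Graph) (d : ℕ) → Partial X d → Set
Move X d p = Σ (V X) λ v → (p v ≡ nothing) × Fin d

Complete : (X : Graph) {d : ℕ} → Partial X d → Coloring X d → Set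
Complete X p c = ∀ v → p v ≡ just (c v)

data Player : Set where
  gentle rascal : Player

-- GentleWins X d t p : Gentle has a winning strategy from position p
-- with player t to move.
data GentleWins (X : Graph) (d : ℕ) : Player → Partial X d → Set where
  finished : ∀ {t p} (c : Coloring X d) → Complete X p c →
             Distinguishing X c → GentleWins X d t p
  gentleMove : ∀ {p} (v : V X) → p v ≡ nothing → (col : Fin d) →
               GentleWins X d rascal (update X p v col) →
               GentleWins X d gentle p
  rascalMove : ∀ {p} → Move X d p →
               (∀ (v : V X) → p v ≡ nothing → (col : Fin d) →
                  GentleWins X d gentle (update X p v col)) →
               GentleWins X d rascal p

emptyPos : (X : Graph) (d : ℕ) → Partial X d
emptyPos X d _ = nothing

GentleWinsR : Graph → ℕ → Set
GentleWinsR X d = GentleWins X d rascal (emptyPos X d)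

D-R≡ : Graph → ℕ → Set
D-R≡ X n = GentleWinsR X n × (∀ d → d Data.Nat.< n → ¬ GentleWinsR X d)

module Submission where

-- D_R(K₂ □ Kₘ) = m for m ≥ 5, where K₂ □ Kₘ is viewed as a 2 × m grid ("prism") whose columns
-- are the copies of K₂ and whose rows are the copies of Kₘ.
--
-- Two facts about colourings of the prism drive the proof: a colouring with two identically
-- coloured columns is never distinguishing (swap the columns), and, for m ≥ 3, a colouring whose
-- columns are pairwise distinct as unordered pairs of colours, one of them using two colours, is
-- distinguishing (automorphisms map columns to columns since only vertices of a column lack a
-- common neighbour; unique colour pairs then fix every column and the two-coloured column fixes
-- the rows).
--
-- Upper bound (any m ≥ 3): Gentle answers every move of Rascal in the same column and, by a
-- pigeonhole count, can always pick her colour so that the final colouring satisfies the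
-- criterion. Lower bound (m ≥ 5, fewer than m colours): Rascal wins with a threat strategy built
-- from a single colour, ending either in twin columns or, by pigeonhole on the bottom row, in a
-- colouring forced to have twin columns.

open import Defs
open import Data.Nat using (ℕ; zero; suc; _+_; _<_; _≤_; _≥_; s≤s; z≤n)
open import Data.Nat.Properties using (n<1+n; ≤-trans)
open import Data.Fin using (Fin; zero; suc; punchIn; punchOut)
open import Data.Fin.Properties
  using ( ¬Fin0; any?; pigeonhole; <⇒≢; <⇒notInjective
        ; punchInᵢ≢i; punchIn-injective; punchOut-injective; punchIn-punchOut)
  renaming (_≟_ to _≟F_)
open import Data.Fin.Permutation using (Permutation′; _⟨$⟩ʳ_; _⟨$⟩ˡ_; inverseˡ; inverseʳ)
import Data.Fin.Permutation as Perm
open import Data.Fin.Permutation.Components using (transpose)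
open import Data.Maybe using (Maybe; just; nothing; fromMaybe)
open import Data.Maybe.Properties using (just-injective) renaming (≡-dec to ≡-decMaybe)
open import Data.Product using (∃; ∃₂; _×_; _,_; proj₁; proj₂; map₂)
open import Data.Sum using (_⊎_; inj₁; inj₂)
open import Data.Empty using (⊥; ⊥-elim)
open import Relation.Nullary using (¬_; Dec; yes; no; ¬?)
open import Relation.Nullary.Decidable using (_×-dec_; _⊎-dec_; map′)
open import Relation.Binary.PropositionalEquality
open import Function.Bundles using (Inverse; Injection; Equivalence; mk↔ₛ′; mk⇔)
open import Function.Properties.Inverse using (↔⇒↣)
open import Data.Fin.Subset using (Subset; _∈_; _∉_; _∪_; ⁅_⁆; Nonempty; _⊃_) renaming (⊥ to ∅)
open import Data.Fin.Subset.Properties using (_∈?_; ∉⊥; x∈⁅x⁆; x∈⁅y⁆⇒x≡y; p⊆p∪q; x∈p∪q⁺; x∈p∪q⁻)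
open import Data.Fin.Subset.Induction using (⊃-wellFounded)
open import Induction.WellFounded using (Acc; acc)

module _ (X : Graph) {d : ℕ} (p : Partial X d) (v : V X) (c : Fin d) where

  update-here : update X p v c v ≡ just c
  update-here with _≟V_ X v v
  ... | yes _   = refl
  ... | no v≢v = ⊥-elim (v≢v refl)

  update-elsewhere : ∀ {w} → w ≢ v → update X p v c w ≡ p w
  update-elsewhere {w} w≢v with _≟V_ X w v
  ... | yes w≡v = ⊥-elim (w≢v w≡v)
  ... | no _    = refl

  update-keeps : p v ≡ nothing → ∀ {w a} → p w ≡ just a → update X p v c w ≡ just a
  update-keeps free {w} coloured = trans (update-elsewhere w≢v) coloured
    where
    w≢v : w ≢ v
    w≢v refl with trans (sym coloured) free
    ... | ()

update-earlier : ∀ (X : Graph) {d} (p : Partial X d) v c w b → v ≢ w → update X (update X p v c) w b v ≡ just c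
update-earlier X p v c w b v≢w = trans (update-elsewhere X (update X p v c) w b v≢w) (update-here X p v c)

no-colours : ∀ {X : Graph} {t p} → V X → ¬ GentleWins X 0 t p
no-colours v (finished c _ _)             = ¬Fin0 (c v)
no-colours v (gentleMove _ _ () _)
no-colours v (rascalMove (_ , _ , ()) _)

automorphism-pullback : ∀ {X : Graph} (φ : Automorphism X) x w →
                        Adj X (Inverse.to (bij φ) x) w → Adj X x (Inverse.from (bij φ) w)
automorphism-pullback {X} φ x w adj =
  Equivalence.from (preserve φ x (Inverse.from (bij φ) w))
    (subst (Adj X (Inverse.to (bij φ) x)) (sym (Inverse.strictlyInverseˡ (bij φ) w)) adj)

transpose-cases : ∀ {n} (i j k : Fin n) →
                  (k ≡ i × transpose i j k ≡ j) ⊎ (k ≡ j × transpose i j k ≡ i) ⊎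
                  (k ≢ i × k ≢ j × transpose i j k ≡ k)
transpose-cases i j k with k ≟F i
... | yes k≡i = inj₁ (k≡i , refl)
... | no k≢i with k ≟F j
...   | yes k≡j = inj₂ (inj₁ (k≡j , refl))
...   | no k≢j  = inj₂ (inj₂ (k≢i , k≢j , refl))

record Avoiding {n} (h j : Fin (suc (suc n))) : Set where
  field
    pick      : Fin n → Fin (suc (suc n))
    pick≢h    : ∀ k → pick k ≢ h
    pick≢j    : ∀ k → pick k ≢ j
    injective : ∀ {k k'} → pick k ≡ pick k' → k ≡ k'

avoiding : ∀ {n} (h j : Fin (suc (suc n))) → Avoiding h j
avoiding h j with h ≟F j
... | yes refl = record
  { pick      = λ k → punchIn h (punchIn zero k)
  ; pick≢h    = λ k → punchInᵢ≢i h _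
  ; pick≢j    = λ k → punchInᵢ≢i h _
  ; injective = λ e → punchIn-injective zero _ _ (punchIn-injective h _ _ e)
  }
... | no h≢j = record
  { pick      = λ k → punchIn h (punchIn (punchOut h≢j) k)
  ; pick≢h    = λ k → punchInᵢ≢i h _
  ; pick≢j    = λ k e → punchInᵢ≢i (punchOut h≢j) k
                          (punchIn-injective h _ _ (trans e (sym (punchIn-punchOut h≢j))))
  ; injective = λ e → punchIn-injective (punchOut h≢j) _ _ (punchIn-injective h _ _ e)
  }

injection-hits : ∀ {n} (j : Fin (suc n)) (g : Fin (suc n) → Fin (suc n)) →
                 (∀ b → g b ≢ j) → (∀ {b b'} → g b ≡ g b' → b ≡ b') → ⊥
injection-hits {n} j g misses injective =
  <⇒notInjective {f = λ b → punchOut (j≢g b)} (n<1+n n)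
    (λ {b} {b'} e → injective (punchOut-injective (j≢g b) (j≢g b') e))
  where
  j≢g : ∀ b → j ≢ g b
  j≢g b e = misses b (sym e)

data _≈ₚ_ {A : Set} : A × A → A × A → Set where
  same    : ∀ {a b} → (a , b) ≈ₚ (a , b)
  swapped : ∀ {a b} → (a , b) ≈ₚ (b , a)

≈ₚ-sym : ∀ {A : Set} {x y : A × A} → x ≈ₚ y → y ≈ₚ x
≈ₚ-sym same    = same
≈ₚ-sym swapped = swapped

≈ₚ-trans : ∀ {A : Set} {x y z : A × A} → x ≈ₚ y → y ≈ₚ z → x ≈ₚ z
≈ₚ-trans same    q       = q
≈ₚ-trans swapped same    = swapped
≈ₚ-trans swapped swapped = same

≈ₚ-partner : ∀ {A : Set} {a b b' : A} → (a , b) ≈ₚ (a , b') → b ≡ b'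
≈ₚ-partner same    = refl
≈ₚ-partner swapped = refl

≈ₚ-distinct : ∀ {A : Set} {a b a' b' : A} → (a , b) ≈ₚ (a' , b') → a ≢ b → a' ≢ b'
≈ₚ-distinct same    a≢b = a≢b
≈ₚ-distinct swapped a≢b = λ e → a≢b (sym e)

_≈ₚ?_ : ∀ {n} (x y : Fin n × Fin n) → Dec (x ≈ₚ y)
(a , b) ≈ₚ? (a' , b') =
  map′ fromEqs toEqs ((a ≟F a' ×-dec b ≟F b') ⊎-dec (a ≟F b' ×-dec b ≟F a'))
  where
  fromEqs : (a ≡ a' × b ≡ b') ⊎ (a ≡ b' × b ≡ a') → (a , b) ≈ₚ (a' , b')
  fromEqs (inj₁ (refl , refl)) = same
  fromEqs (inj₂ (refl , refl)) = swapped
  toEqs : (a , b) ≈ₚ (a' , b') → (a ≡ a' × b ≡ b') ⊎ (a ≡ b' × b ≡ a')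
  toEqs same    = inj₁ (refl , refl)
  toEqs swapped = inj₂ (refl , refl)

anyPair? : ∀ {n} {P : Fin n × Fin n → Set} → (∀ y → Dec (P y)) → Dec (∃ P)
anyPair? P? = map′ (λ (y₁ , y₂ , py) → (y₁ , y₂) , py) (λ ((y₁ , y₂) , py) → y₁ , y₂ , py)
                   (any? λ y₁ → any? λ y₂ → P? (y₁ , y₂))

just-fromMaybe : ∀ {A : Set} (default : A) {x : Maybe A} {a} → x ≡ just a → x ≡ just (fromMaybe default x)
just-fromMaybe default refl = refl

-- The prism K₂ □ Kₘ: vertices (i , j) with row i ∈ Fin 2 and column j ∈ Fin m.
Prism : ℕ → Graph
Prism m = K 2 □ K m

top bottom : Fin 2
top    = zero
bottom = suc zero

otherRow : Fin 2 → Fin 2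
otherRow zero       = suc zero
otherRow (suc zero) = zero

otherRow-≢ : ∀ i → i ≢ otherRow i
otherRow-≢ zero       ()
otherRow-≢ (suc zero) ()

otherRow-unique : ∀ {i r} → i ≢ r → r ≡ otherRow i
otherRow-unique {zero}     {zero}     i≢r = ⊥-elim (i≢r refl)
otherRow-unique {zero}     {suc zero} _   = refl
otherRow-unique {suc zero} {zero}     _   = refl
otherRow-unique {suc zero} {suc zero} i≢r = ⊥-elim (i≢r refl)

two-rows : ∀ {A : Set} (f : Fin 2 → A) {r₀ r₁} → r₀ ≢ r₁ → (f top , f bottom) ≈ₚ (f r₀ , f r₁)
two-rows f {zero}     {zero}     r₀≢r₁ = ⊥-elim (r₀≢r₁ refl)
two-rows f {zero}     {suc zero} _     = same
two-rows f {suc zero} {zero}     _     = swapped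
two-rows f {suc zero} {suc zero} r₀≢r₁ = ⊥-elim (r₀≢r₁ refl)

columnPermutation : ∀ {m} → Permutation′ m → Automorphism (Prism m)
columnPermutation {m} π = record
  { bij      = mk↔ₛ′ (map₂ (π ⟨$⟩ʳ_)) (map₂ (π ⟨$⟩ˡ_))
                     (λ (i , j) → cong (i ,_) (inverseʳ π)) (λ (i , j) → cong (i ,_) (inverseˡ π))
  ; preserve = λ x y → mk⇔ forward backward
  }
  where
  π-injective : ∀ {j j'} → π ⟨$⟩ʳ j ≡ π ⟨$⟩ʳ j' → j ≡ j'
  π-injective = Injection.injective (↔⇒↣ π)
  forward : ∀ {x y} → Adj (Prism m) x y → Adj (Prism m) (map₂ (π ⟨$⟩ʳ_) x) (map₂ (π ⟨$⟩ʳ_) y)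
  forward (inj₁ (i≢i' , j≡j')) = inj₁ (i≢i' , cong (π ⟨$⟩ʳ_) j≡j')
  forward (inj₂ (i≡i' , j≢j')) = inj₂ (i≡i' , λ e → j≢j' (π-injective e))
  backward : ∀ {x y} → Adj (Prism m) (map₂ (π ⟨$⟩ʳ_) x) (map₂ (π ⟨$⟩ʳ_) y) → Adj (Prism m) x y
  backward (inj₁ (i≢i' , πj≡πj')) = inj₁ (i≢i' , π-injective πj≡πj')
  backward (inj₂ (i≡i' , πj≢πj')) = inj₂ (i≡i' , λ e → πj≢πj' (cong (π ⟨$⟩ʳ_) e))

-- A colouring in which two distinct columns look alike is not distinguishing:
-- transposing those two columns preserves it.
twin-columns : ∀ {m d} (c : Coloring (Prism m) d) {j j'} → j ≢ j' →
               (∀ i → c (i , j) ≡ c (i , j')) → ¬ Distinguishing (Prism m) c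
twin-columns {m} c {j} {j'} j≢j' twins distinguishing =
  moves-j (cong proj₂ (distinguishing (columnPermutation (Perm.transpose j j')) preserved (top , j)))
  where
  preserved : ∀ x → c (map₂ (transpose j j') x) ≡ c x
  preserved (i , k) with transpose-cases j j' k
  ... | inj₁ (refl , τk≡j')        = trans (cong (λ z → c (i , z)) τk≡j') (sym (twins i))
  ... | inj₂ (inj₁ (refl , τk≡j)) = trans (cong (λ z → c (i , z)) τk≡j) (twins i)
  ... | inj₂ (inj₂ (_ , _ , τk≡k)) = cong (λ z → c (i , z)) τk≡k
  moves-j : transpose j j' j ≢ j
  moves-j with transpose-cases j j' j
  ... | inj₁ (_ , τj≡j')           = λ τj≡j → j≢j' (trans (sym τj≡j) τj≡j')
  ... | inj₂ (inj₁ (j≡j' , _))     = λ _ → j≢j' j≡j'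
  ... | inj₂ (inj₂ (j≢j , _))      = λ _ → j≢j refl

column-no-common-neighbour : ∀ {m} i j (w : Fin 2 × Fin m) →
  Adj (Prism m) (i , j) w → Adj (Prism m) (otherRow i , j) w → ⊥
column-no-common-neighbour i j w (inj₁ (i≢r , _)) (inj₁ (i'≢r , _)) = i'≢r (sym (otherRow-unique i≢r))
column-no-common-neighbour i j w (inj₁ (_ , j≡s)) (inj₂ (_ , j≢s))  = j≢s j≡s
column-no-common-neighbour i j w (inj₂ (_ , j≢s)) (inj₁ (_ , j≡s))  = j≢s j≡s
column-no-common-neighbour i j w (inj₂ (i≡r , _)) (inj₂ (i'≡r , _)) = otherRow-≢ i (trans i≡r (sym i'≡r))

-- With at least three columns, two vertices of the same row have a common neighbour (in a third column).
row-common-neighbour : ∀ {n} (x y : Fin 2 × Fin (3 + n)) → proj₁ x ≡ proj₁ y →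
  ∃ λ w → Adj (Prism (3 + n)) x w × Adj (Prism (3 + n)) y w
row-common-neighbour (r , k) (.r , k') refl =
  (r , pick zero) , inj₂ (refl , λ e → pick≢h zero (sym e)) , inj₂ (refl , λ e → pick≢j zero (sym e))
  where open Avoiding (avoiding k k')

-- Hence an automorphism of the prism (m ≥ 3) maps each column into a single column.
columns-preserved : ∀ {n} (φ : Automorphism (Prism (3 + n))) i j →
  proj₂ (Inverse.to (bij φ) (i , j)) ≡ proj₂ (Inverse.to (bij φ) (otherRow i , j))
columns-preserved φ i j with Equivalence.to (preserve φ (i , j) (otherRow i , j)) (inj₁ (otherRow-≢ i , refl))
... | inj₁ (_ , same-column) = same-column
... | inj₂ (same-row , _)
  with row-common-neighbour (Inverse.to (bij φ) (i , j)) (Inverse.to (bij φ) (otherRow i , j)) same-row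
...   | w , adj₁ , adj₂ =
  ⊥-elim (column-no-common-neighbour i j _ (automorphism-pullback φ _ w adj₁) (automorphism-pullback φ _ w adj₂))

column : ∀ {m d} → Coloring (Prism m) d → Fin m → Fin d × Fin d
column c j = c (top , j) , c (bottom , j)

-- Columns must be fixed (their colour pairs are unique), and rows are fixed by column k₀.
distinguishing-criterion : ∀ {n d} (c : Coloring (Prism (3 + n)) d) →
  (∀ {j k} → j ≢ k → ¬ column c j ≈ₚ column c k) →
  ∀ k₀ → c (top , k₀) ≢ c (bottom , k₀) → Distinguishing (Prism (3 + n)) c
distinguishing-criterion {n} c separated k₀ bicoloured φ preserved (i , j) =
  cong₂ _,_ (row-fixed i j) (column-fixed i j)
  where
  T : Fin 2 × Fin (3 + n) → Fin 2 × Fin (3 + n)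
  T = Inverse.to (bij φ)

  top-column-fixed : ∀ j → proj₂ (T (top , j)) ≡ j
  top-column-fixed j with proj₂ (T (top , j)) ≟F j
  ... | yes σ≡j = σ≡j
  ... | no σ≢j  = ⊥-elim (separated σ≢j (subst (column c σ ≈ₚ_) colours image-pair))
    where
    σ : Fin (3 + n)
    σ = proj₂ (T (top , j))
    r₀ r₁ : Fin 2
    r₀ = proj₁ (T (top , j))
    r₁ = proj₁ (T (bottom , j))
    r₀≢r₁ : r₀ ≢ r₁
    r₀≢r₁ r₀≡r₁ with Injection.injective (↔⇒↣ (bij φ)) (cong₂ _,_ r₀≡r₁ (columns-preserved φ top j))
    ... | ()
    image-pair : column c σ ≈ₚ (c (r₀ , σ) , c (r₁ , σ))
    image-pair = two-rows (λ r → c (r , σ)) r₀≢r₁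
    colours : (c (r₀ , σ) , c (r₁ , σ)) ≡ column c j
    colours = cong₂ _,_ (preserved (top , j))
      (trans (cong (λ z → c (r₁ , z)) (columns-preserved φ top j)) (preserved (bottom , j)))

  column-fixed : ∀ i j → proj₂ (T (i , j)) ≡ j
  column-fixed zero       j = top-column-fixed j
  column-fixed (suc zero) j = trans (sym (columns-preserved φ top j)) (top-column-fixed j)

  -- In column k₀ the two colours differ, so the rows cannot be exchanged there.
  row-fixed-at-k₀ : ∀ i → proj₁ (T (i , k₀)) ≡ i
  row-fixed-at-k₀ i with proj₁ (T (i , k₀)) ≟F i
  ... | yes r≡i = r≡i
  ... | no r≢i  = ⊥-elim (bicoloured (swap-colours r≢i same-colour))
    where
    same-colour : c (proj₁ (T (i , k₀)) , k₀) ≡ c (i , k₀)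
    same-colour = trans (cong (λ z → c (proj₁ (T (i , k₀)) , z)) (sym (column-fixed i k₀))) (preserved (i , k₀))
    swap-colours : ∀ {r i} → r ≢ i → c (r , k₀) ≡ c (i , k₀) → c (top , k₀) ≡ c (bottom , k₀)
    swap-colours {zero}     {zero}     r≢i _ = ⊥-elim (r≢i refl)
    swap-colours {zero}     {suc zero} _   e = e
    swap-colours {suc zero} {zero}     _   e = sym e
    swap-colours {suc zero} {suc zero} r≢i _ = ⊥-elim (r≢i refl)

  -- Any other vertex is joined to the fixed vertex (i , k₀) by a row edge, which must stay a row edge.
  row-fixed : ∀ i j → proj₁ (T (i , j)) ≡ i
  row-fixed i j with j ≟F k₀
  ... | yes refl = row-fixed-at-k₀ i
  ... | no j≢k₀ with Equivalence.to (preserve φ (i , j) (i , k₀)) (inj₂ (refl , j≢k₀))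
  ...   | inj₁ (_ , same-column) =
    ⊥-elim (j≢k₀ (trans (sym (column-fixed i j)) (trans same-column (column-fixed i k₀))))
  ...   | inj₂ (same-row , _)    = trans same-row (row-fixed-at-k₀ i)

-- Gentle always colours the
-- other vertex of the column Rascal just touched, so at Rascal's turn every column is blank or
-- filled; she chooses her colour so that filled columns are pairwise distinct unordered pairs and
-- (once anything is filled) some filled column uses two colours. The end position then satisfies
-- the distinguishing criterion. The game terminates because the set of filled columns grows.
module GentleStrategy (n : ℕ) where

  private
    m : ℕ
    m = 3 + n

  Position : Set
  Position = Partial (Prism m) m

  record Filled (p : Position) (j : Fin m) (y : Fin m × Fin m) : Set where
    constructor colours
    field
      top-colour    : p (top , j) ≡ just (proj₁ y)
      bottom-colour : p (bottom , j) ≡ just (proj₂ y)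

  Blank : Position → Fin m → Set
  Blank p j = ∀ r → p (r , j) ≡ nothing

  filled? : ∀ p j y → Dec (Filled p j y)
  filled? p j y = map′ (λ (t , b) → colours t b) (λ (colours t b) → t , b)
                      (≡-decMaybe _≟F_ _ _ ×-dec ≡-decMaybe _≟F_ _ _)

  filled-unique : ∀ {p j y y'} → Filled p j y → Filled p j y' → y ≡ y'
  filled-unique (colours t b) (colours t' b') =
    cong₂ _,_ (just-injective (trans (sym t) t')) (just-injective (trans (sym b) b'))

  filled-not-free : ∀ {p j y} → Filled p j y → ∀ r → p (r , j) ≢ nothing
  filled-not-free (colours t _) zero       free with trans (sym t) free
  ... | ()
  filled-not-free (colours _ b) (suc zero) free with trans (sym b) free
  ... | ()

  filled-transport : ∀ {p q k y} → (∀ r → q (r , k) ≡ p (r , k)) → Filled p k y → Filled q k y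
  filled-transport agree (colours t b) = colours (trans (agree top) t) (trans (agree bottom) b)

  blank-transport : ∀ {p q k} → (∀ r → q (r , k) ≡ p (r , k)) → Blank p k → Blank q k
  blank-transport agree blank r = trans (agree r) (blank r)

  -- Gentle's invariant at Rascal's turn; F is the set of filled columns.
  record Invariant (F : Subset m) (p : Position) : Set where
    field
      blank      : ∀ {j} → j ∉ F → Blank p j
      filled     : ∀ {j} → j ∈ F → ∃ (Filled p j)
      separated  : ∀ {j k x y} → j ≢ k → Filled p j x → Filled p k y → ¬ x ≈ₚ y
      bicoloured : Nonempty F → ∃₂ λ j y → Filled p j y × proj₁ y ≢ proj₂ y

  initial : Invariant ∅ (emptyPos (Prism m) m)
  initial = record
    { blank      = λ _ _ → refl
    ; filled     = λ j∈∅ → ⊥-elim (∉⊥ j∈∅)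
    ; separated  = λ { _ (colours () _) _ }
    ; bicoloured = λ { (_ , j∈∅) → ⊥-elim (∉⊥ j∈∅) }
    }

  filled⇒∈ : ∀ {F p j y} → Invariant F p → Filled p j y → j ∈ F
  filled⇒∈ {F} {j = j} inv f with j ∈? F
  ... | yes j∈F = j∈F
  ... | no j∉F  = ⊥-elim (filled-not-free f top (Invariant.blank inv j∉F top))

  Fresh : Position → Fin m → Fin m → Set
  Fresh p a b = ∀ {k y} → Filled p k y → ¬ (a , b) ≈ₚ y

  record Blocker (p : Position) (a b : Fin m) : Set where
    constructor blocked-by
    field
      at      : Fin m
      pair    : Fin m × Fin m
      carries : Filled p at pair
      matches : (a , b) ≈ₚ pair

  blocker? : ∀ p a b → Dec (Blocker p a b)
  blocker? p a b =
    map′ (λ (k , y , f , ab≈y) → blocked-by k y f ab≈y) (λ (blocked-by k y f ab≈y) → k , y , f , ab≈y)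
         (any? λ k → anyPair? λ y → filled? p k y ×-dec ((a , b) ≈ₚ? y))

  -- If every b ≢ a is blocked, then distinct b are blocked by distinct
  -- columns, all different from the blank column j; so {a , a} cannot also be blocked, as that
  -- would inject all m colours into the other m - 1 columns. Such a blocked b also exhibits a
  -- filled column, so a loop {a , a} is only used once something is filled.
  partner : ∀ {F p j} → Invariant F p → j ∉ F → ∀ a → ∃ λ b → Fresh p a b × (a ≢ b ⊎ Nonempty F)
  partner {F} {p} {j} inv j∉F a with any? (λ b → ¬? (a ≟F b) ×-dec ¬? (blocker? p a b))
  ... | yes (b , a≢b , unblocked) = b , (λ f ab≈y → unblocked (blocked-by _ _ f ab≈y)) , inj₁ a≢b
  ... | no none = a , loop-fresh , inj₂ (_ , filled⇒∈ inv (Blocker.carries some-blocker))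
    where
    all-blocked : ∀ b → a ≢ b → Blocker p a b
    all-blocked b a≢b with blocker? p a b
    ... | yes blocked = blocked
    ... | no ¬blocked = ⊥-elim (none (b , a≢b , ¬blocked))

    some-blocker : Blocker p a (punchIn a zero)
    some-blocker = all-blocked (punchIn a zero) (λ e → punchInᵢ≢i a zero (sym e))

    not-at-blank : ∀ {b} (β : Blocker p a b) → Blocker.at β ≢ j
    not-at-blank (blocked-by k y f _) refl = filled-not-free f top (Invariant.blank inv j∉F top)

    same-blocker : ∀ {b b'} (β : Blocker p a b) (β' : Blocker p a b') → Blocker.at β ≡ Blocker.at β' → b ≡ b'
    same-blocker (blocked-by k y f ab≈y) (blocked-by .k y' f' ab'≈y') refl =
      ≈ₚ-partner (≈ₚ-trans ab≈y (subst (_≈ₚ (a , _)) (filled-unique f' f) (≈ₚ-sym ab'≈y')))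

    loop-fresh : Fresh p a a
    loop-fresh {k₀} {y₀} f₀ aa≈y₀ =
      injection-hits j (λ b → Blocker.at (blocker b))
        (λ b → not-at-blank (blocker b)) (λ e → same-blocker (blocker _) (blocker _) e)
      where
      blocker : ∀ b → Blocker p a b
      blocker b with a ≟F b
      ... | yes refl = blocked-by k₀ y₀ f₀ aa≈y₀
      ... | no a≢b   = all-blocked b a≢b

  fillColumn : Position → Fin 2 → Fin m → Fin m → Fin m → Position
  fillColumn p i j a b = update (Prism m) (update (Prism m) p (i , j) a) (otherRow i , j) b

  fillColumn-elsewhere : ∀ p i j a b {k} → k ≢ j → ∀ r → fillColumn p i j a b (r , k) ≡ p (r , k)
  fillColumn-elsewhere p i j a b {k} k≢j r =
    trans (update-elsewhere (Prism m) (update (Prism m) p (i , j) a) (otherRow i , j) b {r , k} other-column)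
          (update-elsewhere (Prism m) p (i , j) a {r , k} other-column)
    where
    other-column : ∀ {i'} → (r , k) ≢ (i' , j)
    other-column e = k≢j (cong proj₂ e)

  fillColumn-filled : ∀ p i j a b → ∃ λ y → Filled (fillColumn p i j a b) j y × y ≈ₚ (a , b)
  fillColumn-filled p zero j a b =
    (a , b) , colours (update-earlier (Prism m) p (top , j) a (bottom , j) b (λ ()))
                      (update-here (Prism m) (update (Prism m) p (top , j) a) (bottom , j) b) , same
  fillColumn-filled p (suc zero) j a b =
    (b , a) , colours (update-here (Prism m) (update (Prism m) p (bottom , j) a) (top , j) b)
                      (update-earlier (Prism m) p (bottom , j) a (top , j) b (λ ())) , swapped

  fill-invariant : ∀ {F p j} → Invariant F p → j ∉ F → ∀ i a b → Fresh p a b → (a ≢ b ⊎ Nonempty F) →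
                   Invariant (F ∪ ⁅ j ⁆) (fillColumn p i j a b)
  fill-invariant {F} {p} {j} inv j∉F i a b fresh progress = record
    { blank      = blank'
    ; filled     = filled'
    ; separated  = separated'
    ; bicoloured = λ _ → bicoloured' progress
    }
    where
    open Invariant inv
    q : Position
    q = fillColumn p i j a b
    elsewhere : ∀ {k} → k ≢ j → ∀ r → q (r , k) ≡ p (r , k)
    elsewhere = fillColumn-elsewhere p i j a b
    back : ∀ {k y} → k ≢ j → Filled q k y → Filled p k y
    back k≢j = filled-transport (λ r → sym (elsewhere k≢j r))
    new : ∃ λ y → Filled q j y × y ≈ₚ (a , b)
    new = fillColumn-filled p i j a b
    old≢j : ∀ {k} → k ∈ F → k ≢ j
    old≢j k∈F refl = j∉F k∈F

    blank' : ∀ {k} → k ∉ F ∪ ⁅ j ⁆ → Blank q k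
    blank' {k} k∉F' = blank-transport {p} {q} (elsewhere k≢j) (blank (λ k∈F → k∉F' (x∈p∪q⁺ (inj₁ k∈F))))
      where
      k≢j : k ≢ j
      k≢j refl = k∉F' (x∈p∪q⁺ (inj₂ (x∈⁅x⁆ j)))

    filled' : ∀ {k} → k ∈ F ∪ ⁅ j ⁆ → ∃ (Filled q k)
    filled' {k} k∈F' with x∈p∪q⁻ F ⁅ j ⁆ k∈F'
    ... | inj₁ k∈F = map₂ (filled-transport (elsewhere (old≢j k∈F))) (filled k∈F)
    ... | inj₂ k∈j with x∈⁅y⁆⇒x≡y j k∈j
    ...   | refl = proj₁ new , proj₁ (proj₂ new)

    new-vs-old : ∀ {k x y} → k ≢ j → Filled q j x → Filled q k y → ¬ x ≈ₚ y
    new-vs-old k≢j fj fk x≈y = fresh (back k≢j fk)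
      (≈ₚ-trans (≈ₚ-sym (proj₂ (proj₂ new))) (subst (_≈ₚ _) (filled-unique fj (proj₁ (proj₂ new))) x≈y))

    separated' : ∀ {k k' x y} → k ≢ k' → Filled q k x → Filled q k' y → ¬ x ≈ₚ y
    separated' {k} {k'} k≢k' fk fk' with k ≟F j | k' ≟F j
    ... | yes refl | yes refl = ⊥-elim (k≢k' refl)
    ... | yes refl | no k'≢j  = new-vs-old k'≢j fk fk'
    ... | no k≢j   | yes refl = λ x≈y → new-vs-old k≢j fk' fk (≈ₚ-sym x≈y)
    ... | no k≢j   | no k'≢j  = separated k≢k' (back k≢j fk) (back k'≢j fk')

    bicoloured' : (a ≢ b ⊎ Nonempty F) → ∃₂ λ k y → Filled q k y × proj₁ y ≢ proj₂ y
    bicoloured' (inj₁ a≢b) = j , proj₁ new , proj₁ (proj₂ new) , ≈ₚ-distinct (≈ₚ-sym (proj₂ (proj₂ new))) a≢b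
    bicoloured' (inj₂ nonempty) with bicoloured nonempty
    ... | k , y , fk , y₁≢y₂ = k , y , filled-transport (elsewhere (old≢j (filled⇒∈ inv fk))) fk , y₁≢y₂

  all-filled-wins : ∀ {F p t} → Invariant F p → (∀ j → j ∈ F) → GentleWins (Prism m) m t p
  all-filled-wins {F} {p} inv all-in =
    finished c complete (distinguishing-criterion c (λ j≢k → separated j≢k (as-filled _) (as-filled _))
                                                  (proj₁ k₀) (proj₂ k₀))
    where
    open Invariant inv
    c : Coloring (Prism m) m
    c w = fromMaybe zero (p w)
    complete : Complete (Prism m) p c
    complete (zero , j)     = just-fromMaybe zero (Filled.top-colour (proj₂ (filled (all-in j))))
    complete (suc zero , j) = just-fromMaybe zero (Filled.bottom-colour (proj₂ (filled (all-in j))))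
    as-filled : ∀ j → Filled p j (column c j)
    as-filled j = colours (complete (top , j)) (complete (bottom , j))
    two-colours : (∃₂ λ k y → Filled p k y × proj₁ y ≢ proj₂ y) → ∃ λ k → c (top , k) ≢ c (bottom , k)
    two-colours (k , y , fk , y₁≢y₂) =
      k , subst (λ y → proj₁ y ≢ proj₂ y) (filled-unique fk (as-filled k)) y₁≢y₂
    k₀ : ∃ λ k → c (top , k) ≢ c (bottom , k)
    k₀ = two-colours (bicoloured (zero , all-in zero))

  strategy : ∀ F → Acc _⊃_ F → ∀ p → Invariant F p → GentleWins (Prism m) m rascal p
  strategy F (acc larger) p inv with any? (λ j → ¬? (j ∈? F))
  ... | no none = all-filled-wins inv in-F
    where
    in-F : ∀ j → j ∈ F
    in-F j with j ∈? F
    ... | yes j∈F = j∈F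
    ... | no j∉F  = ⊥-elim (none (j , j∉F))
  ... | yes (j , j∉F) = rascalMove ((top , j) , Invariant.blank inv j∉F top , zero) respond
    where
    played-blank : ∀ {i j'} → p (i , j') ≡ nothing → j' ∉ F
    played-blank {i} free j'∈F = filled-not-free (proj₂ (Invariant.filled inv j'∈F)) i free

    respond : ∀ v → p v ≡ nothing → ∀ a → GentleWins (Prism m) m gentle (update (Prism m) p v a)
    respond (i , j') free a with partner inv (played-blank free) a
    ... | b , fresh , progress =
      gentleMove (otherRow i , j') other-free b
        (strategy (F ∪ ⁅ j' ⁆) (larger grows) (fillColumn p i j' a b)
                  (fill-invariant inv (played-blank free) i a b fresh progress))
      where
      other-free : update (Prism m) p (i , j') a (otherRow i , j') ≡ nothing
      other-free = trans (update-elsewhere (Prism m) p (i , j') a (λ e → otherRow-≢ i (sym (cong proj₁ e))))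
                         (Invariant.blank inv (played-blank free) (otherRow i))
      grows : (F ∪ ⁅ j' ⁆) ⊃ F
      grows = p⊆p∪q ⁅ j' ⁆ , j' , x∈p∪q⁺ (inj₂ (x∈⁅x⁆ j')) , played-blank free

gentle-wins : ∀ {m} → 3 ≤ m → GentleWinsR (Prism m) m
gentle-wins {suc (suc (suc n))} (s≤s (s≤s (s≤s _))) =
  strategy ∅ (⊃-wellFounded ∅) (emptyPos (Prism (3 + n)) (3 + n)) initial
  where open GentleStrategy n

-- Rascal uses one colour x and works
-- with columns that are pending (x on top, bottom uncoloured), closed (x on top, bottom
-- coloured) or blank. A closed column next to a pending one is a threat: Rascal copies the closed
-- column into the pending one and the final colouring has twin columns. Rascal opens pending
-- columns until Gentle can no longer parry all threats; if Gentle parries by closing every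
-- pending column, all columns end up closed and pigeonhole on the d bottom colours yields twins.
module RascalStrategy (n d : ℕ) (few-colours : suc d < 5 + n) where

  private
    m D : ℕ
    m = 5 + n
    D = suc d

  Position : Set
  Position = Partial (Prism m) D

  x : Fin D
  x = zero

  record Pending (p : Position) (h : Fin m) : Set where
    constructor pending
    field
      started : p (top , h) ≡ just x
      waiting : p (bottom , h) ≡ nothing

  record Closed (p : Position) (f : Fin m) (b : Fin D) : Set where
    constructor closed
    field
      started : p (top , f) ≡ just x
      shut    : p (bottom , f) ≡ just b

  record Blank (p : Position) (e : Fin m) : Set where
    constructor blank
    field
      top-free    : p (top , e) ≡ nothing
      bottom-free : p (bottom , e) ≡ nothing

  Settled : Position → Fin m → Set
  Settled p j = Blank p j ⊎ ∃ (Closed p j)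

  record Twins (p : Position) : Set where
    constructor twin-columns-at
    field
      j j'     : Fin m
      distinct : j ≢ j'
      alike    : ∀ r → ∃ λ a → p (r , j) ≡ just a × p (r , j') ≡ just a

  pending≢blank : ∀ {p h e} → Pending p h → Blank p e → h ≢ e
  pending≢blank (pending started _) (blank top-free _) refl with trans (sym started) top-free
  ... | ()

  pending≢closed : ∀ {p h f b} → Pending p h → Closed p f b → h ≢ f
  pending≢closed (pending _ waiting) (closed _ shut) refl with trans (sym waiting) shut
  ... | ()

  data RascalToMove (p : Position) : Set where
    twins                   : Twins p → RascalToMove p
    threat                  : ∀ {f b h} → Closed p f b → Pending p h → RascalToMove p
    three-pending           : ∀ {h₁ h₂ h₃} → h₁ ≢ h₂ → h₁ ≢ h₃ → h₂ ≢ h₃ →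
                              Pending p h₁ → Pending p h₂ → Pending p h₃ → RascalToMove p
    two-pending-one-blank   : ∀ {h₁ h₂ e} → h₁ ≢ h₂ → Pending p h₁ → Pending p h₂ → Blank p e → RascalToMove p
    one-pending-three-blank : ∀ {h e₁ e₂ e₃} → e₁ ≢ e₂ → e₁ ≢ e₃ → e₂ ≢ e₃ →
                              Pending p h → Blank p e₁ → Blank p e₂ → Blank p e₃ → RascalToMove p
    all-settled             : (∀ j → Settled p j) → RascalToMove p

  data GentleToMove (p : Position) : Set where
    twins                 : Twins p → GentleToMove p
    double-threat         : ∀ {f b h₁ h₂} → h₁ ≢ h₂ → Closed p f b → Pending p h₁ → Pending p h₂ → GentleToMove p
    three-pending         : ∀ {h₁ h₂ h₃} → h₁ ≢ h₂ → h₁ ≢ h₃ → h₂ ≢ h₃ →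
                            Pending p h₁ → Pending p h₂ → Pending p h₃ → GentleToMove p
    two-pending-two-blank : ∀ {h₁ h₂ e₁ e₂} → h₁ ≢ h₂ → e₁ ≢ e₂ →
                            Pending p h₁ → Pending p h₂ → Blank p e₁ → Blank p e₂ → GentleToMove p
    one-pending           : ∀ {h} → Pending p h → (∀ j → j ≢ h → Settled p j) → GentleToMove p

  open-column : ∀ {p e} (bl : Blank p e) → Pending (update (Prism m) p (top , e) x) e
  open-column {p} {e} (blank _ bottom-free) =
    pending (update-here (Prism m) p (top , e) x)
            (trans (update-elsewhere (Prism m) p (top , e) x {bottom , e} (λ ())) bottom-free)

  close-column : ∀ {p h} (ph : Pending p h) b → Closed (update (Prism m) p (bottom , h) b) h b
  close-column {p} {h} (pending started waiting) b =
    closed (update-keeps (Prism m) p (bottom , h) b waiting started) (update-here (Prism m) p (bottom , h) b)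

  module Effect (p : Position) (v : Fin 2 × Fin m) (free : p v ≡ nothing) (c : Fin D) where
    q : Position
    q = update (Prism m) p v c

    keeps : ∀ {w a} → p w ≡ just a → q w ≡ just a
    keeps = update-keeps (Prism m) p v c free

    untouched : ∀ {w} → w ≢ v → q w ≡ p w
    untouched = update-elsewhere (Prism m) p v c

    twins-kept : Twins p → Twins q
    twins-kept (twin-columns-at j j' j≢j' alike) =
      twin-columns-at j j' j≢j' λ r → map₂ (λ (e , e') → keeps e , keeps e') (alike r)

    closed-kept : ∀ {f b} → Closed p f b → Closed q f b
    closed-kept (closed started shut) = closed (keeps started) (keeps shut)

    pending-kept : ∀ {h} → v ≢ (bottom , h) → Pending p h → Pending q h
    pending-kept v≢ (pending started waiting) =
      pending (keeps started) (trans (untouched (λ e → v≢ (sym e))) waiting)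

    blank-kept : ∀ {e} → proj₂ v ≢ e → Blank p e → Blank q e
    blank-kept v≢e (blank t b) = blank (trans (untouched elsewhere) t) (trans (untouched elsewhere) b)
      where
      elsewhere : ∀ {r} → (r , _) ≢ v
      elsewhere e = v≢e (sym (cong proj₂ e))

    settled-kept : ∀ {j} → proj₂ v ≢ j → Settled p j → Settled q j
    settled-kept v≢j (inj₁ bl)        = inj₁ (blank-kept v≢j bl)
    settled-kept v≢j (inj₂ (b , cl)) = inj₂ (b , closed-kept cl)

    pending-step : ∀ {h} → Pending p h → (v ≡ (bottom , h) × Closed q h c) ⊎ Pending q h
    pending-step {h} ph with _≟V_ (Prism m) v (bottom , h)
    ... | yes refl = inj₁ (refl , close-column ph c)
    ... | no v≢    = inj₂ (pending-kept v≢ ph)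

    -- A move closes at most one of two pending columns; closing one creates a threat.
    two-pending-step : ∀ {h₁ h₂} → h₁ ≢ h₂ → Pending p h₁ → Pending p h₂ →
                       RascalToMove q ⊎ (Pending q h₁ × Pending q h₂)
    two-pending-step h₁≢h₂ ph₁ ph₂ with pending-step ph₁ | pending-step ph₂
    ... | inj₁ (refl , _) | inj₁ (e , _)     = ⊥-elim (h₁≢h₂ (cong proj₂ e))
    ... | inj₁ (_ , ch₁)  | inj₂ ph₂'        = inj₁ (threat ch₁ ph₂')
    ... | inj₂ ph₁'       | inj₁ (_ , ch₂)   = inj₁ (threat ch₂ ph₁')
    ... | inj₂ ph₁'       | inj₂ ph₂'        = inj₂ (ph₁' , ph₂')

    gentle-step : GentleToMove p → RascalToMove q
    gentle-step (twins tw) = twins (twins-kept tw)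
    gentle-step (double-threat h₁≢h₂ cf ph₁ ph₂) with two-pending-step h₁≢h₂ ph₁ ph₂
    ... | inj₁ won        = won
    ... | inj₂ (ph₁' , _) = threat (closed-kept cf) ph₁'
    gentle-step (three-pending h₁≢h₂ h₁≢h₃ h₂≢h₃ ph₁ ph₂ ph₃)
      with two-pending-step h₁≢h₂ ph₁ ph₂ | pending-step ph₃
    ... | inj₁ won           | _              = won
    ... | inj₂ (ph₁' , _)    | inj₁ (_ , ch₃) = threat ch₃ ph₁'
    ... | inj₂ (ph₁' , ph₂') | inj₂ ph₃'      = three-pending h₁≢h₂ h₁≢h₃ h₂≢h₃ ph₁' ph₂' ph₃'
    gentle-step (two-pending-two-blank {e₁ = e₁} h₁≢h₂ e₁≢e₂ ph₁ ph₂ be₁ be₂)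
      with two-pending-step h₁≢h₂ ph₁ ph₂ | proj₂ v ≟F e₁
    ... | inj₁ won           | _        = won
    ... | inj₂ (ph₁' , ph₂') | yes refl = two-pending-one-blank h₁≢h₂ ph₁' ph₂' (blank-kept e₁≢e₂ be₂)
    ... | inj₂ (ph₁' , ph₂') | no v≢e₁  = two-pending-one-blank h₁≢h₂ ph₁' ph₂' (blank-kept v≢e₁ be₁)
    -- If Gentle does not close the pending column h, three columns other than h and the one she
    -- played in (this is where m ≥ 5 is used) are still settled: blank, or closed and hence a threat.
    gentle-step (one-pending {h} ph rest) with pending-step ph
    ... | inj₁ (refl , ch) = all-settled settled
      where
      settled : ∀ j → Settled q j
      settled j with j ≟F h
      ... | yes refl = inj₂ (c , ch)
      ... | no j≢h   = settled-kept (λ e → j≢h (sym e)) (rest j j≢h)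
    ... | inj₂ ph' =
      three-columns (blank-or-threat zero) (blank-or-threat (suc zero)) (blank-or-threat (suc (suc zero)))
      where
      open Avoiding (avoiding h (proj₂ v))
      blank-or-threat : ∀ k → Blank q (pick k) ⊎ RascalToMove q
      blank-or-threat k with settled-kept (λ e → pick≢j k (sym e)) (rest (pick k) (pick≢h k))
      ... | inj₁ bl       = inj₁ bl
      ... | inj₂ (_ , cl) = inj₂ (threat cl ph')
      three-columns : Blank q (pick zero) ⊎ RascalToMove q → Blank q (pick (suc zero)) ⊎ RascalToMove q →
                      Blank q (pick (suc (suc zero))) ⊎ RascalToMove q → RascalToMove q
      three-columns (inj₁ b₀) (inj₁ b₁) (inj₁ b₂) =
        one-pending-three-blank (λ e → 0≢1 (injective e)) (λ e → 0≢2 (injective e)) (λ e → 1≢2 (injective e))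
                                ph' b₀ b₁ b₂
        where
        0≢1 : _≢_ {A = Fin (3 + n)} zero (suc zero)
        0≢1 ()
        0≢2 : _≢_ {A = Fin (3 + n)} zero (suc (suc zero))
        0≢2 ()
        1≢2 : _≢_ {A = Fin (3 + n)} (suc zero) (suc (suc zero))
        1≢2 ()
      three-columns (inj₂ won) _ _ = won
      three-columns _ (inj₂ won) _ = won
      three-columns _ _ (inj₂ won) = won

  record Reply (p : Position) : Set where
    constructor reply
    field
      vertex : Fin 2 × Fin m
      free   : p vertex ≡ nothing
      colour : Fin D
      next   : GentleToMove (update (Prism m) p vertex colour)

  rascal-reply : ∀ {p} → RascalToMove p → Move (Prism m) D p → Reply p
  rascal-reply (twins tw) (v , free , c) = reply v free c (twins (Effect.twins-kept _ v free c tw))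
  -- A threat is executed by copying the closed column f into the pending column h.
  rascal-reply {p} (threat {f} {b} {h} cf ph) _ =
    reply (bottom , h) (Pending.waiting ph) b (twins (twin-columns-at h f (pending≢closed ph cf) alike))
    where
    open Effect p (bottom , h) (Pending.waiting ph) b
    alike : ∀ r → ∃ λ a → q (r , h) ≡ just a × q (r , f) ≡ just a
    alike zero       = x , Closed.started (close-column ph b) , keeps (Closed.started cf)
    alike (suc zero) = b , Closed.shut (close-column ph b) , keeps (Closed.shut cf)
  rascal-reply {p} (three-pending {h₁} h₁≢h₂ h₁≢h₃ h₂≢h₃ ph₁ ph₂ ph₃) _ =
    reply (bottom , h₁) (Pending.waiting ph₁) x
      (double-threat h₂≢h₃ (close-column ph₁ x)
        (pending-kept (λ e → h₁≢h₂ (cong proj₂ e)) ph₂) (pending-kept (λ e → h₁≢h₃ (cong proj₂ e)) ph₃))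
    where open Effect p (bottom , h₁) (Pending.waiting ph₁) x
  rascal-reply {p} (two-pending-one-blank {e = e} h₁≢h₂ ph₁ ph₂ be) _ =
    reply (top , e) (Blank.top-free be) x
      (three-pending h₁≢h₂ (pending≢blank ph₁ be) (pending≢blank ph₂ be)
        (pending-kept (λ ()) ph₁) (pending-kept (λ ()) ph₂) (open-column be))
    where open Effect p (top , e) (Blank.top-free be) x
  rascal-reply {p} (one-pending-three-blank {e₁ = e₁} e₁≢e₂ e₁≢e₃ e₂≢e₃ ph be₁ be₂ be₃) _ =
    reply (top , e₁) (Blank.top-free be₁) x
      (two-pending-two-blank (pending≢blank ph be₁) e₂≢e₃
        (pending-kept (λ ()) ph) (open-column be₁) (blank-kept e₁≢e₂ be₂) (blank-kept e₁≢e₃ be₃))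
    where open Effect p (top , e₁) (Blank.top-free be₁) x
  -- Gentle still had a legal move, so some column is not yet closed, i.e. blank; Rascal opens it.
  rascal-reply {p} (all-settled settled) ((i , j) , free-ij , _) with settled j
  ... | inj₂ (_ , cj) = ⊥-elim (closed-not-free i cj free-ij)
    where
    closed-not-free : ∀ {f b} r → Closed p f b → p (r , f) ≢ nothing
    closed-not-free zero       (closed started _) free with trans (sym started) free
    ... | ()
    closed-not-free (suc zero) (closed _ shut) free with trans (sym shut) free
    ... | ()
  ... | inj₁ bj =
    reply (top , j) (Blank.top-free bj) x
      (one-pending (open-column bj) λ k k≢j → settled-kept (λ e → k≢j (sym e)) (settled k))
    where open Effect p (top , j) (Blank.top-free bj) x

  Doomed : Position → Set
  Doomed p = Twins p ⊎ ∃ (Pending p) ⊎ (∀ j → Settled p j)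

  doomed-final : ∀ {p} → Doomed p → ∀ c → Complete (Prism m) p c → ¬ Distinguishing (Prism m) c
  doomed-final {p} (inj₁ (twin-columns-at j j' j≢j' alike)) c complete =
    twin-columns c j≢j' λ r → let (_ , e , e') = alike r in trans (value e) (sym (value e'))
    where
    value : ∀ {w a} → p w ≡ just a → c w ≡ a
    value {w} e = just-injective (trans (sym (complete w)) e)
  doomed-final (inj₂ (inj₁ (_ , pending _ waiting))) c complete _ with trans (sym (complete (bottom , _))) waiting
  ... | ()
  -- All columns settled and the colouring complete: every top is x and the m bottoms use fewer
  -- than m colours, so two columns coincide.
  doomed-final {p} (inj₂ (inj₂ settled)) c complete with pigeonhole few-colours (λ k → c (bottom , k))
  ... | i , j , i<j , same-bottom =
    twin-columns c (<⇒≢ i<j) λ { zero → trans (top-is-x i) (sym (top-is-x j)) ; (suc zero) → same-bottom }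
    where
    top-is-x : ∀ k → c (top , k) ≡ x
    top-is-x k with settled k
    ... | inj₂ (_ , closed started _) = just-injective (trans (sym (complete (top , k))) started)
    ... | inj₁ (blank top-free _) with trans (sym (complete (top , k))) top-free
    ...   | ()

  rascal-doomed : ∀ {p} → RascalToMove p → Doomed p
  rascal-doomed (twins tw)                               = inj₁ tw
  rascal-doomed (threat _ ph)                            = inj₂ (inj₁ (_ , ph))
  rascal-doomed (three-pending _ _ _ ph _ _)             = inj₂ (inj₁ (_ , ph))
  rascal-doomed (two-pending-one-blank _ ph _ _)         = inj₂ (inj₁ (_ , ph))
  rascal-doomed (one-pending-three-blank _ _ _ ph _ _ _) = inj₂ (inj₁ (_ , ph))
  rascal-doomed (all-settled settled)                    = inj₂ (inj₂ settled)

  gentle-doomed : ∀ {p} → GentleToMove p → Doomed p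
  gentle-doomed (twins tw)                           = inj₁ tw
  gentle-doomed (double-threat _ _ ph _)             = inj₂ (inj₁ (_ , ph))
  gentle-doomed (three-pending _ _ _ ph _ _)         = inj₂ (inj₁ (_ , ph))
  gentle-doomed (two-pending-two-blank _ _ ph _ _ _) = inj₂ (inj₁ (_ , ph))
  gentle-doomed (one-pending ph _)                   = inj₂ (inj₁ (_ , ph))

  rascal-wins-from : ∀ {p} → RascalToMove p → ¬ GentleWins (Prism m) D rascal p
  gentle-loses-from : ∀ {p} → GentleToMove p → ¬ GentleWins (Prism m) D gentle p

  rascal-wins-from s (finished c complete distinguishing) = doomed-final (rascal-doomed s) c complete distinguishing
  rascal-wins-from s (rascalMove move answers) =
    gentle-loses-from next (answers vertex free colour)
    where open Reply (rascal-reply s move)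

  gentle-loses-from s (finished c complete distinguishing) = doomed-final (gentle-doomed s) c complete distinguishing
  gentle-loses-from {p} s (gentleMove v free c strategy) = rascal-wins-from (Effect.gentle-step p v free c s) strategy

  rascal-wins : ¬ GentleWinsR (Prism m) D
  rascal-wins = rascal-wins-from (all-settled λ j → inj₁ (blank refl refl))

rascal-wins : ∀ {m d} → 5 ≤ m → d < m → ¬ GentleWinsR (Prism m) d
rascal-wins {d = zero}  (s≤s _) _ = no-colours (zero , zero)
rascal-wins {d = suc d} (s≤s (s≤s (s≤s (s≤s (s≤s {n = n} _))))) d<m = RascalStrategy.rascal-wins n d d<m

proposition3p2 : ∀ (m : ℕ) → m ≥ 5 → D-R≡ (K 2 □ K m) m
proposition3p2 m m≥5 = gentle-wins (≤-trans (s≤s (s≤s (s≤s z≤n))) m≥5) , λ d d<m → rascal-wins m≥5 d<m
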